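{- Let $x$ be an infinite word (over an arbitrary alphabet) that avoids $3$-anti-powers. Then $x$ is a binary word, i.e. at most two distinct letters occur in $x$.
   Context: A $k$-anti-power is a word $u_1\cdots u_k$ with $u_1,\ldots,u_k$ non-empty words of the same length that are pairwise distinct. An infinite word avoids $k$-anti-powers if none of its factors (blocks of consecutive letters) is a $k$-anti-power. -}

module Defs where

open import Data.Nat using (ℕ; _+_; _*_; _≥_)
open import Data.Fin using (Fin; toℕ)
open import Data.Product using (Σ; ∃; _×_)
open import Relation.Binary.PropositionalEquality using (_≡_; _≢_)
open import Relation.Nullary using (¬_)

InfWord : Set → Set
InfWord A = ℕ → A

block : {A : Set} → InfWord A → (i m : ℕ) → Fin m → A
block x i m k = x (i + toℕ k)

SameWord : {A : Set} {m : ℕ} → (Fin m → A) → (Fin m → A) → Set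
SameWord u v = ∀ k → u k ≡ v k

Has3AntiPowerAt : {A : Set} → InfWord A → (i m : ℕ) → Set
Has3AntiPowerAt x i m =
  m ≥ 1 ×
  ¬ SameWord (block x i m) (block x (i + m) m) ×
  ¬ SameWord (block x i m) (block x (i + 2 * m) m) ×
  ¬ SameWord (block x (i + m) m) (block x (i + 2 * m) m)

Avoids3AntiPowers : {A : Set} → InfWord A → Set
Avoids3AntiPowers x = ∀ i m → ¬ Has3AntiPowerAt x i m

IsBinary : {A : Set} → InfWord A → Set
IsBinary x = ∀ i j k → ¬ (x i ≢ x j × x i ≢ x k × x j ≢ x k)

-- Three distinct letters yield, by minimality of their span, a factor a bⁿ⁻¹ c
-- with a, b, c pairwise distinct and n ≥ 2, so it suffices to refute such a
-- factor.  If n = 2m + t with t < m, the three blocks of length m starting at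
-- the a are pairwise distinct: the first two differ at offset 0 (a versus b),
-- and the third differs from the others at offset t, where it carries the c.
-- The only length not of this form is n = 3, and there the factor abbc forces
-- a 3-anti-power within the next three letters.
module Submission where

open import Defs
open import Data.Nat using (ℕ; zero; suc; _+_; _*_; _∸_; _≤_; _<_; s≤s; z<s; s<s)
open import Data.Nat.Properties
open import Algebra.Properties.CommutativeSemigroup +-commutativeSemigroup
  using (xy∙z≈xz∙y)
open import Data.Fin using (toℕ; fromℕ<)
open import Data.Fin.Properties using (toℕ-fromℕ<)
open import Data.Product using (_×_; _,_; proj₁; proj₂; ∃-syntax; ∃₂)
open import Data.Empty using (⊥)
open import Function using (_∘_)
open import Relation.Binary using (tri<; tri≈; tri>)
open import Relation.Binary.PropositionalEquality
open import Relation.Nullary using (¬_; yes; no)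
open import Relation.Nullary.Decidable using (¬¬-excluded-middle)

suffix : {A : Set} → ℕ → InfWord A → InfWord A
suffix p x n = x (n + p)

Distinct₃ : {A : Set} → A → A → A → Set
Distinct₃ a b c = a ≢ b × a ≢ c × b ≢ c

module _ {A : Set} {a b c : A} where

  Distinct₃-swap₁₂ : Distinct₃ a b c → Distinct₃ b a c
  Distinct₃-swap₁₂ (a≢b , a≢c , b≢c) = ≢-sym a≢b , b≢c , a≢c

  Distinct₃-swap₂₃ : Distinct₃ a b c → Distinct₃ a c b
  Distinct₃-swap₂₃ (a≢b , a≢c , b≢c) = a≢c , a≢b , ≢-sym b≢c

module _ {A : Set} (x : InfWord A) where

  Sorted¬Distinct₃ : Set
  Sorted¬Distinct₃ = ∀ {p q r} → p < q → q < r → ¬ Distinct₃ (x p) (x q) (x r)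

  Sorted¬Distinct₃⇒¬Distinct₃-< : Sorted¬Distinct₃ →
                                  ∀ {i j k} → i < j → ¬ Distinct₃ (x i) (x j) (x k)
  Sorted¬Distinct₃⇒¬Distinct₃-< sorted {i} {j} {k} i<j d with <-cmp j k
  ... | tri< j<k _ _ = sorted i<j j<k d
  ... | tri≈ _ j≡k _ = proj₂ (proj₂ d) (cong x j≡k)
  ... | tri> _ _ k<j with <-cmp i k
  ...   | tri< i<k _ _ = sorted i<k k<j (Distinct₃-swap₂₃ d)
  ...   | tri≈ _ i≡k _ = proj₁ (proj₂ d) (cong x i≡k)
  ...   | tri> _ _ k<i = sorted k<i i<j (Distinct₃-swap₁₂ (Distinct₃-swap₂₃ d))

  Sorted¬Distinct₃⇒IsBinary : Sorted¬Distinct₃ → IsBinary x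
  Sorted¬Distinct₃⇒IsBinary sorted i j k d with <-cmp i j
  ... | tri< i<j _ _ = Sorted¬Distinct₃⇒¬Distinct₃-< sorted i<j d
  ... | tri≈ _ i≡j _ = proj₁ d (cong x i≡j)
  ... | tri> _ _ j<i = Sorted¬Distinct₃⇒¬Distinct₃-< sorted j<i (Distinct₃-swap₁₂ d)

  -- Constancy only up to double negation: letter equality is undecidable, and
  -- this is what the minimality argument below yields constructively.
  ConstantBetween : A → ℕ → ℕ → Set
  ConstantBetween b p r = ∀ s → p < s → s < r → ¬ x s ≢ b

  FlankedRun : A → ℕ → ℕ → Set
  FlankedRun b p r = Distinct₃ (x p) b (x r) × ConstantBetween b p r

  HasFlankedRun : Set
  HasFlankedRun = ∃[ p ] ∃[ r ] ∃[ b ] 2 + p ≤ r × FlankedRun b p r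

  FlankedRun-≢-end : ∀ {b n} → FlankedRun b 0 n → ∀ s → s < n → ¬ ¬ (x s ≢ x n)
  FlankedRun-≢-end ((_ , a≢c , _) , _) zero _ = λ k → k a≢c
  FlankedRun-≢-end ((_ , _ , b≢c) , between) (suc s) s<n = λ k →
    between (suc s) z<s s<n λ xₛ≡b → k λ xₛ≡c → b≢c (trans (sym xₛ≡b) xₛ≡c)

  private
    shorten-end : ∀ {p q r} n → q < r → r ≤ p + suc n → q ≤ p + n
    shorten-end {p} n q<r r≤p+1+n =
      ≤-pred (≤-trans q<r (≤-trans r≤p+1+n (≤-reflexive (+-suc p n))))

    shorten-start : ∀ {p s r} n → p < s → r ≤ p + suc n → r ≤ s + n
    shorten-start {p} n p<s r≤p+1+n =
      ≤-trans (≤-trans r≤p+1+n (≤-reflexive (+-suc p n))) (+-monoˡ-≤ n p<s)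

  Distinct₃⇒HasFlankedRun′ : ∀ n {p q r} → r ≤ p + n → p < q → q < r →
                             Distinct₃ (x p) (x q) (x r) → ¬ ¬ HasFlankedRun
  Distinct₃⇒HasFlankedRun′ zero {p} r≤p+0 p<q q<r _ _ =
    <⇒≱ (<-trans p<q q<r) (≤-trans r≤p+0 (≤-reflexive (+-identityʳ p)))
  Distinct₃⇒HasFlankedRun′ (suc n) {p} {q} {r} r≤p+1+n p<q q<r d@(a≢b , a≢c , b≢c) noRun =
    noRun (p , r , x q , ≤-trans (s≤s p<q) q<r , d , between)
    where
    between : ConstantBetween (x q) p r
    between s p<s s<r xₛ≢b with <-cmp s q
    ... | tri< s<q _ _ = ¬¬-excluded-middle λ where
      (yes xₛ≡c) → Distinct₃⇒HasFlankedRun′ n (shorten-end n q<r r≤p+1+n) p<s s<q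
                     ((λ e → a≢c (trans e xₛ≡c)) , a≢b , xₛ≢b) noRun
      (no xₛ≢c) → Distinct₃⇒HasFlankedRun′ n (shorten-start n p<s r≤p+1+n) s<q q<r
                    (xₛ≢b , xₛ≢c , b≢c) noRun
    ... | tri≈ _ s≡q _ = xₛ≢b (cong x s≡q)
    ... | tri> _ _ q<s = ¬¬-excluded-middle λ where
      (yes xₛ≡a) → Distinct₃⇒HasFlankedRun′ n (shorten-start n p<q r≤p+1+n) q<s s<r
                     (≢-sym xₛ≢b , b≢c , λ e → a≢c (trans (sym xₛ≡a) e)) noRun
      (no xₛ≢a) → Distinct₃⇒HasFlankedRun′ n (shorten-end n s<r r≤p+1+n) p<q q<s
                    (a≢b , ≢-sym xₛ≢a , ≢-sym xₛ≢b) noRun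

  Distinct₃⇒HasFlankedRun : ∀ {p q r} → p < q → q < r →
                            Distinct₃ (x p) (x q) (x r) → ¬ ¬ HasFlankedRun
  Distinct₃⇒HasFlankedRun {p} {r = r} = Distinct₃⇒HasFlankedRun′ r (m≤n+m r p)

FlankedRun-suffix : {A : Set} (x : InfWord A) → ∀ {b p n} →
                    FlankedRun x b p (n + p) → FlankedRun (suffix p x) b 0 n
FlankedRun-suffix x {p = p} (d , between) =
  d , λ s 0<s s<n → between (s + p) (+-monoˡ-< p 0<s) (+-monoˡ-< p s<n)

module _ {A : Set} (x : InfWord A) where

  SameWord⇒≡ : ∀ {i j m} t → t < m → SameWord (block x i m) (block x j m) →
               x (i + t) ≡ x (j + t)
  SameWord⇒≡ {i} {j} t t<m same =
    subst (λ k → x (i + k) ≡ x (j + k)) (toℕ-fromℕ< t<m) (same (fromℕ< t<m))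

  ≢⇒¬SameWord : ∀ i j {m u v} t → t < m → x (i + t) ≡ u → x (j + t) ≡ v → u ≢ v →
               ¬ SameWord (block x i m) (block x j m)
  ≢⇒¬SameWord _ _ t t<m refl refl u≢v = u≢v ∘ SameWord⇒≡ t t<m

  SameWord-suffix : ∀ p i j {i′ j′ m} → i′ ≡ i + p → j′ ≡ j + p →
                    SameWord (block x i′ m) (block x j′ m) →
                    SameWord (block (suffix p x) i m) (block (suffix p x) j m)
  SameWord-suffix p i j refl refl same k =
    trans (cong x (xy∙z≈xz∙y i (toℕ k) p))
          (trans (same k) (cong x (sym (xy∙z≈xz∙y j (toℕ k) p))))

  Avoids3AntiPowers-suffix : Avoids3AntiPowers x → ∀ p → Avoids3AntiPowers (suffix p x)
  Avoids3AntiPowers-suffix avoid p i m (m≥1 , ¬same₁₂ , ¬same₁₃ , ¬same₂₃) =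
    avoid (i + p) m
      ( m≥1
      , ¬same₁₂ ∘ SameWord-suffix p i (i + m) refl (xy∙z≈xz∙y i p m)
      , ¬same₁₃ ∘ SameWord-suffix p i (i + 2 * m) refl (xy∙z≈xz∙y i p (2 * m))
      , ¬same₂₃ ∘ SameWord-suffix p (i + m) (i + 2 * m)
                    (xy∙z≈xz∙y i p m) (xy∙z≈xz∙y i p (2 * m)))

halve : ∀ k → ∃₂ λ m t → t < m × 2 * m + t ≡ 4 + k
halve 0 = 2 , 0 , z<s , refl
halve 1 = 2 , 1 , s<s z<s , refl
halve (suc (suc k)) with halve k
... | m , t , t<m , 2m+t≡4+k =
  suc m , t , m<n⇒m<1+n t<m , trans (cong (_+ t) (*-suc 2 m)) (cong (2 +_) 2m+t≡4+k)

module _ {A : Set} (y : InfWord A) (avoid : Avoids3AntiPowers y) {b : A} where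

  ¬FlankedRun-2*m+t : ∀ m t → t < m → ¬ FlankedRun y b 0 (2 * m + t)
  ¬FlankedRun-2*m+t m@(suc _) t t<m run@((a≢b , _ , b≢c) , between) =
    between (m + 0) z<s (middle 0 z<s) λ yₘ≡b →
    between (m + t) z<s (middle t t<m) λ yₘ₊ₜ≡b →
    FlankedRun-≢-end y run t (m<n+m t z<s) λ yₜ≢c →
    avoid 0 m
      ( z<s
      , ≢⇒¬SameWord y 0 m 0 z<s refl yₘ≡b a≢b
      , ≢⇒¬SameWord y 0 (2 * m) t t<m refl refl yₜ≢c
      , ≢⇒¬SameWord y m (2 * m) t t<m yₘ₊ₜ≡b refl b≢c)
    where
    middle : ∀ s → s < m → m + s < 2 * m + t
    middle s s<m =
      <-≤-trans (+-monoʳ-< m (<-≤-trans s<m (m≤m+n m 0))) (m≤m+n (2 * m) t)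

  ¬FlankedRun-3 : ¬ FlankedRun y b 0 3
  ¬FlankedRun-3 ((a≢b , a≢c , b≢c) , between) =
    between 1 z<s (s<s z<s) λ y₁≡b →
    between 2 z<s (s<s (s<s z<s)) λ y₂≡b →
    ¬¬-excluded-middle λ where
      (yes y₄≡b) → after-abbcb y₁≡b y₂≡b y₄≡b
      (no y₄≢b) → ¬¬-excluded-middle λ where
        (yes y₄≡c) → avoid 0 2
          ( z<s
          , ≢⇒¬SameWord y 0 2 0 z<s refl y₂≡b a≢b
          , ≢⇒¬SameWord y 0 4 0 z<s refl y₄≡c a≢c
          , ≢⇒¬SameWord y 2 4 0 z<s y₂≡b y₄≡c b≢c)
        (no y₄≢c) → avoid 2 1
          ( z<s
          , ≢⇒¬SameWord y 2 3 0 z<s y₂≡b refl b≢c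
          , ≢⇒¬SameWord y 2 4 0 z<s y₂≡b refl (≢-sym y₄≢b)
          , ≢⇒¬SameWord y 3 4 0 z<s refl refl (≢-sym y₄≢c))
    where
    -- y 5 and y 6 are forced to be c and b, and then abb·cbc·b is an anti-power.
    after-abbcb : y 1 ≡ b → y 2 ≡ b → y 4 ≡ b → ⊥
    after-abbcb y₁≡b y₂≡b y₄≡b = ¬¬-excluded-middle λ where
      (no y₅≢c) → avoid 0 2
        ( z<s
        , ≢⇒¬SameWord y 0 2 0 z<s refl y₂≡b a≢b
        , ≢⇒¬SameWord y 0 4 0 z<s refl y₄≡b a≢b
        , ≢⇒¬SameWord y 2 4 1 (s<s z<s) refl refl (≢-sym y₅≢c))
      (yes y₅≡c) → ¬¬-excluded-middle λ where
        (no y₆≢b) → avoid 1 2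
          ( z<s
          , ≢⇒¬SameWord y 1 3 0 z<s y₁≡b refl b≢c
          , ≢⇒¬SameWord y 1 5 0 z<s y₁≡b y₅≡c b≢c
          , ≢⇒¬SameWord y 3 5 1 (s<s z<s) y₄≡b refl (≢-sym y₆≢b))
        (yes y₆≡b) → avoid 0 3
          ( z<s
          , ≢⇒¬SameWord y 0 3 0 z<s refl refl a≢c
          , ≢⇒¬SameWord y 0 6 0 z<s refl y₆≡b a≢b
          , ≢⇒¬SameWord y 3 6 0 z<s refl y₆≡b (≢-sym b≢c))

  ¬FlankedRun-origin : ∀ {n} → 2 ≤ n → ¬ FlankedRun y b 0 n
  ¬FlankedRun-origin {1} (s≤s ())
  ¬FlankedRun-origin {2} _ = ¬FlankedRun-2*m+t 1 0 z<s
  ¬FlankedRun-origin {3} _ = ¬FlankedRun-3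
  ¬FlankedRun-origin {suc (suc (suc (suc k)))} _ with halve k
  ... | m , t , t<m , 2m+t≡4+k =
    subst (¬_ ∘ FlankedRun y b 0) 2m+t≡4+k (¬FlankedRun-2*m+t m t t<m)

¬FlankedRun : {A : Set} (x : InfWord A) → Avoids3AntiPowers x →
              ∀ {b p r} → 2 + p ≤ r → ¬ FlankedRun x b p r
¬FlankedRun x avoid {p = p} {r} 2+p≤r with r ∸ p | m∸n+n≡m (≤-trans (m≤n+m p 2) 2+p≤r)
... | n | refl =
  ¬FlankedRun-origin (suffix p x) (Avoids3AntiPowers-suffix x avoid p)
                     (+-cancelʳ-≤ p 2 n 2+p≤r)
  ∘ FlankedRun-suffix x

lemma9 : {A : Set} (x : InfWord A) → Avoids3AntiPowers x → IsBinary x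
lemma9 x avoid = Sorted¬Distinct₃⇒IsBinary x λ p<q q<r d →
  Distinct₃⇒HasFlankedRun x p<q q<r d λ (_ , _ , _ , 2+p≤r , run) →
  ¬FlankedRun x avoid 2+p≤r run
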